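{- Let $G$ be a graph with tree-length $\lambda$ having a shortest path with eccentricity $k$. Let $x$ and $y$ be two mutually furthest vertices of $G$, i.e. $\operatorname{ecc}(x)=\operatorname{ecc}(y)=d_G(x,y)$. Then every shortest path from $x$ to $y$ has eccentricity at most $k+2.5\lambda$.
   Context: Graphs are finite, connected, unweighted, undirected and simple; $d_G$ is shortest-path distance, $\operatorname{ecc}(v)=\max_u d_G(u,v)$, $d_G(v,S)=\min_{u\in S}d_G(u,v)$, $\operatorname{ecc}(S)=\max_{u\in V}d_G(u,S)$. A tree-decomposition of $G=(V,E)$ is a tree $\mathcal{T}$ whose nodes (bags) are subsets of $V$ such that every vertex lies in some bag, every edge has both ends in some bag, and for each vertex the bags containing it induce a subtree. $G$ has tree-length $\lambda$ if it has a tree-decomposition in which every bag $B$ has $\max_{u,v\in B}d_G(u,v)\le\lambda$. -}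

module Defs where

open import Data.Nat using (ℕ; zero; suc; _≤_; _+_; _*_)
open import Data.Fin using (Fin; toℕ) renaming (suc to fsuc)
open import Data.List using (List; []; _∷_; length)
open import Data.List.Membership.Propositional using (_∈_)
open import Data.List.Relation.Unary.All using (All)
open import Data.Product using (Σ; ∃; ∃-syntax; _×_; _,_)
open import Data.Sum using (_⊎_)
open import Relation.Nullary using (¬_)
open import Relation.Binary.PropositionalEquality using (_≡_)

record Graph (n : ℕ) : Set₁ where
  field
    Adj     : Fin n → Fin n → Set
    symm    : ∀ {u v} → Adj u v → Adj v u
    irrefl  : ∀ {u} → ¬ Adj u u

-- Walks along a relation R, recorded by their list of vertices
-- (both end-points included). A walk with vertex list l has length (length l - 1).
data Walk {A : Set} (R : A → A → Set) : A → A → List A → Set where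
  here : ∀ u → Walk R u u (u ∷ [])
  step : ∀ {u w v l} → R u w → Walk R w v l → Walk R u v (u ∷ l)

-- d is the shortest-path distance of G: for all u v there is a walk of
-- length d u v, and every walk from u to v has length ≥ d u v.
-- (Totality of d together with the first clause encodes connectedness.)
IsShortestPathDistance : ∀ {n} → Graph n → (Fin n → Fin n → ℕ) → Set
IsShortestPathDistance G d =
  ∀ u v → (∃[ l ] (Walk (Graph.Adj G) u v l × length l ≡ suc (d u v)))
        × (∀ l → Walk (Graph.Adj G) u v l → suc (d u v) ≤ length l)

IsShortestPath : ∀ {n} → Graph n → (Fin n → Fin n → ℕ) → Fin n → Fin n → List (Fin n) → Set
IsShortestPath G d x y P = Walk (Graph.Adj G) x y P × length P ≡ suc (d x y)

-- ecc(S) = e  where ecc(S) = max_u d(u,S) and d(u,S) = min_{s∈S} d(u,s).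
EccSet : ∀ {n} → (Fin n → Fin n → ℕ) → List (Fin n) → ℕ → Set
EccSet d S e =
  (∀ u → ∃[ s ] (s ∈ S × d u s ≤ e))
  × (∃[ u ] (∀ s → s ∈ S → e ≤ d u s))

EccVertex : ∀ {n} → (Fin n → Fin n → ℕ) → Fin n → ℕ → Set
EccVertex d v e = (∀ u → d v u ≤ e) × (∃[ u ] (d v u ≡ e))

MutuallyFurthest : ∀ {n} → (Fin n → Fin n → ℕ) → Fin n → Fin n → Set
MutuallyFurthest d x y = EccVertex d x (d x y) × EccVertex d y (d x y)

-- Trees on the node set Fin (suc m): node (fsuc i) has a parent of index ≤ i.
-- Every finite tree arises this way (order nodes e.g. by BFS from a root).
record Tree (m : ℕ) : Set where
  field
    parent    : Fin m → Fin (suc m)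
    parent-lt : ∀ i → toℕ (parent i) ≤ toℕ i

TreeAdj : ∀ {m} → Tree m → Fin (suc m) → Fin (suc m) → Set
TreeAdj T a b = ∃[ i ] ((a ≡ fsuc i × b ≡ Tree.parent T i) ⊎ (b ≡ fsuc i × a ≡ Tree.parent T i))

record TreeDecomposition {n : ℕ} (G : Graph n) : Set₁ where
  field
    m       : ℕ
    tree    : Tree m
    bag     : Fin (suc m) → List (Fin n)
    covers  : ∀ v → ∃[ t ] (v ∈ bag t)
    edges   : ∀ u v → Graph.Adj G u v → ∃[ t ] (u ∈ bag t × v ∈ bag t)
    subtree : ∀ v t t' → v ∈ bag t → v ∈ bag t' →
              ∃[ l ] (Walk (TreeAdj tree) t t' l × All (λ s → v ∈ bag s) l)

HasTreeLength : ∀ {n} → (G : Graph n) → (Fin n → Fin n → ℕ) → ℕ → Set₁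
HasTreeLength G d tl =
  Σ (TreeDecomposition G) λ D →
    ∀ t u v → u ∈ TreeDecomposition.bag D t → v ∈ TreeDecomposition.bag D t → d u v ≤ tl

-- Let v be a vertex at distance ecc(P) from P. Taking a deepest node of the
-- decomposition tree whose subtree meets the bags of two of x, y, v yields a bag B
-- that separates each pair among x, y, v. Project x, y, v onto the shortest path Q
-- of eccentricity k. If no projecting route meets B, order the three projections
-- along Q: the walk from the outer vertices through Q to the middle one crosses B on
-- both sides of the middle projection, at two points of Q at distance ≤ λ, so the
-- middle vertex is within k + λ/2 of B. Hence one of x, y, v is within k + λ/2 of B.
-- P meets B in some p. If v is that vertex, d(v,p) ≤ k + 3λ/2. If x is, the
-- shortest v–y path meets B in some w, and d(v,w) + d(w,y) = d(v,y) ≤ ecc(y) =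
-- d(x,y) ≤ d(x,w) + d(w,y) gives d(v,w) ≤ d(x,w) ≤ k + 3λ/2, so d(v,p) ≤ k + 5λ/2;
-- the case of y is symmetric.
module Submission where

open import Defs
open import Data.Nat using (ℕ; zero; suc; _≤_; _<_; _+_; _*_; z≤n; s≤s; s≤s⁻¹)
open import Data.Nat.Properties
open import Data.Nat.Tactic.RingSolver using (solve-∀)
open import Data.Fin using (Fin; toℕ) renaming (zero to fzero; suc to fsuc)
import Data.Fin.Properties as Finₚ
open import Data.List using (List; length; _++_; [_])
open import Data.List.Properties using (length-++)
open import Data.List.Membership.Propositional using (_∈_; _∉_; find; lose)
open import Data.List.Membership.Propositional.Properties using (∈-++⁻)
open import Data.List.Relation.Unary.Any using (here; there; any?)
import Data.List.Relation.Unary.All as All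
open import Data.Product using (∃; ∃-syntax; _×_; _,_; proj₁; proj₂)
open import Data.Sum using (_⊎_; inj₁; inj₂; [_,_]′)
import Data.Sum as Sum
open import Data.Empty using (⊥; ⊥-elim)
open import Function using (_∘_)
open import Relation.Nullary using (¬_; Dec; yes; no; _×-dec_; _⊎-dec_; ¬?)
open import Relation.Unary using (Decidable)
open import Relation.Binary.PropositionalEquality
  using (_≡_; _≢_; refl; sym; trans; cong; cong₂; subst; subst₂)

gaps-≤ : ∀ {p r s t} D₁ D₂ → p + D₁ ≤ r → r + D₂ ≤ s → s ≤ p + t → D₁ + D₂ ≤ t
gaps-≤ {p} {r} {s} {t} D₁ D₂ h₁ h₂ h₃ = +-cancelˡ-≤ p (D₁ + D₂) t (begin
  p + (D₁ + D₂) ≡⟨ +-assoc p D₁ D₂ ⟨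
  p + D₁ + D₂   ≤⟨ +-monoˡ-≤ D₂ h₁ ⟩
  r + D₂        ≤⟨ h₂ ⟩
  s             ≤⟨ h₃ ⟩
  p + t         ∎)
  where open ≤-Reasoning

smaller-half : ∀ a b {t} → a + b ≤ t → 2 * a ≤ t ⊎ 2 * b ≤ t
smaller-half a b a+b≤t with ≤-total a b
... | inj₁ a≤b = inj₁ (≤-trans (+-monoʳ-≤ a (≤-trans (≤-reflexive (+-identityʳ a)) a≤b)) a+b≤t)
... | inj₂ b≤a = inj₂ (≤-trans (+-monoʳ-≤ b (≤-trans (≤-reflexive (+-identityʳ b)) b≤a))
                        (≤-trans (≤-reflexive (+-comm b a)) a+b≤t))

double-+-≤ : ∀ {x s} a t → x ≤ a + t → 2 * a ≤ s → 2 * x ≤ s + 2 * t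
double-+-≤ {x} {s} a t x≤a+t 2a≤s = begin
  2 * x         ≤⟨ *-monoʳ-≤ 2 x≤a+t ⟩
  2 * (a + t)   ≡⟨ *-distribˡ-+ 2 a t ⟩
  2 * a + 2 * t ≤⟨ +-monoˡ-≤ (2 * t) 2a≤s ⟩
  s + 2 * t     ∎
  where open ≤-Reasoning

Between : ℕ → ℕ → ℕ → Set
Between i j k = (i ≤ j × j ≤ k) ⊎ (k ≤ j × j ≤ i)

middle-of-three : ∀ i j k → Between j i k ⊎ Between i j k ⊎ Between i k j
middle-of-three i j k with ≤-total i j | ≤-total j k
... | inj₁ i≤j | inj₁ j≤k = inj₂ (inj₁ (inj₁ (i≤j , j≤k)))
... | inj₂ j≤i | inj₂ k≤j = inj₂ (inj₁ (inj₂ (k≤j , j≤i)))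
... | inj₁ i≤j | inj₂ k≤j with ≤-total i k
...   | inj₁ i≤k = inj₂ (inj₂ (inj₁ (i≤k , k≤j)))
...   | inj₂ k≤i = inj₁ (inj₂ (k≤i , i≤j))
middle-of-three i j k | inj₂ j≤i | inj₁ j≤k with ≤-total i k
...   | inj₁ i≤k = inj₁ (inj₁ (j≤i , i≤k))
...   | inj₂ k≤i = inj₂ (inj₂ (inj₂ (j≤k , k≤i)))

largest-witness : ∀ {N} {P : Fin N → Set} → Decidable P → ∃ P →
                  ∃[ i ] (P i × ∀ j → toℕ i < toℕ j → ¬ P j)
largest-witness {suc N} P? (i , Pi) with Finₚ.any? (P? ∘ fsuc)
... | yes P∘fsuc with largest-witness (P? ∘ fsuc) P∘fsuc
...   | i′ , Pi′ , larger = fsuc i′ , Pi′ , λ { (fsuc j) (s≤s i′<j) → larger j i′<j }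
largest-witness {suc N} P? (fzero , P0) | no ¬P∘fsuc = fzero , P0 , λ { (fsuc j) _ Pj → ¬P∘fsuc (j , Pj) }
largest-witness {suc N} P? (fsuc i , Pi) | no ¬P∘fsuc = ⊥-elim (¬P∘fsuc (i , Pi))

module _ {A : Set} {R : A → A → Set} where

  start∈ : ∀ {u v l} → Walk R u v l → u ∈ l
  start∈ (here u)   = here refl
  start∈ (step _ _) = here refl

  walk-snoc : ∀ {u v w l} → Walk R u v l → R v w → Walk R u w (l ++ [ w ])
  walk-snoc (here u)    r = step r (here _)
  walk-snoc (step r′ W) r = step r′ (walk-snoc W r)

  walk-join : ∀ {u v w l₁ l₂} → Walk R u v l₁ → Walk R v w l₂ →
              ∃[ l ] (Walk R u w l × suc (length l) ≡ length l₁ + length l₂ ×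
                      (∀ {z} → z ∈ l → z ∈ l₁ ⊎ z ∈ l₂))
  walk-join (here u)    W₂ = _ , W₂ , refl , inj₂
  walk-join (step r W₁) W₂ with walk-join W₁ W₂
  ... | l , W , len , mem = _ , step r W , cong suc len ,
        λ { (here z≡u) → inj₁ (here z≡u) ; (there z∈l) → Sum.map₁ there (mem z∈l) }

  walk-split : ∀ {u v z l} → Walk R u v l → z ∈ l →
               ∃[ l₁ ] ∃[ l₂ ] (Walk R u z l₁ × Walk R z v l₂ × length l₁ + length l₂ ≡ suc (length l))
  walk-split (here u)   (here refl) = _ , _ , here u , here u , refl
  walk-split (step r W) (here refl) = _ , _ , here _ , step r W , refl
  walk-split (step r W) (there z∈l) with walk-split W z∈l
  ... | _ , _ , W₁ , W₂ , len = _ , _ , step r W₁ , W₂ , cong suc len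

  walk-reverse : (∀ {a b} → R a b → R b a) → ∀ {u v l} → Walk R u v l →
                 ∃[ l′ ] (Walk R v u l′ × length l′ ≡ length l × (∀ {z} → z ∈ l′ → z ∈ l))
  walk-reverse sym-R (here u) = _ , here u , refl , λ z∈ → z∈
  walk-reverse sym-R (step {u} r W) with walk-reverse sym-R W
  ... | l′ , W′ , len , mem = l′ ++ [ u ] , walk-snoc W′ (sym-R r) ,
        trans (length-++ l′) (trans (+-comm (length l′) 1) (cong suc len)) ,
        λ z∈ → [ there ∘ mem , (λ { (here z≡u) → here z≡u }) ]′ (∈-++⁻ l′ z∈)

  steps : ∀ {u v l} → Walk R u v l → ℕ
  steps (here _)   = 0
  steps (step _ W) = suc (steps W)

  length≡suc-steps : ∀ {u v l} (W : Walk R u v l) → length l ≡ suc (steps W)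
  length≡suc-steps (here _)   = refl
  length≡suc-steps (step _ W) = cong suc (length≡suc-steps W)

  vertex : ∀ {u v l} → Walk R u v l → ℕ → A
  vertex (here u)         _       = u
  vertex (step {u} _ _)   zero    = u
  vertex (step _ W)       (suc i) = vertex W i

  vertex-start : ∀ {u v l} (W : Walk R u v l) → vertex W 0 ≡ u
  vertex-start (here _)   = refl
  vertex-start (step _ _) = refl

  vertex-end : ∀ {u v l} (W : Walk R u v l) → vertex W (steps W) ≡ v
  vertex-end (here _)   = refl
  vertex-end (step _ W) = vertex-end W

  ∈⇒vertex : ∀ {u v l z} (W : Walk R u v l) → z ∈ l → ∃[ i ] (i ≤ steps W × z ≡ vertex W i)
  ∈⇒vertex (here u)   (here z≡u) = 0 , z≤n , z≡u
  ∈⇒vertex (step r W) (here z≡u) = 0 , z≤n , z≡u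
  ∈⇒vertex (step r W) (there z∈l) with ∈⇒vertex W z∈l
  ... | i , i≤ , z≡ = suc i , s≤s i≤ , z≡

  segment : ∀ {u v l} (W : Walk R u v l) {i j} → i ≤ j → j ≤ steps W →
            ∃[ l′ ] (Walk R (vertex W i) (vertex W j) l′ × i + length l′ ≡ suc j ×
                     (∀ {z} → z ∈ l′ → ∃[ p ] (i ≤ p × p ≤ j × z ≡ vertex W p)))
  segment (here u) {zero} {zero} _ _ = _ , here u , refl , λ { (here z≡u) → 0 , z≤n , z≤n , z≡u }
  segment (step {u} r W) {zero} {zero} _ _ = _ , here u , refl , λ { (here z≡u) → 0 , z≤n , z≤n , z≡u }
  segment (step r W) {zero} {suc j} _ (s≤s j≤) with segment W z≤n j≤
  ... | l′ , W′ , len , mem =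
        _ , step r (subst (λ s → Walk R s (vertex W j) l′) (vertex-start W) W′) , cong suc len ,
        λ { (here z≡u) → 0 , z≤n , z≤n , z≡u
          ; (there z∈) → let (p , _ , p≤j , z≡) = mem z∈ in suc p , z≤n , s≤s p≤j , z≡ }
  segment (step r W) {suc i} {suc j} (s≤s i≤j) (s≤s j≤) with segment W i≤j j≤
  ... | l′ , W′ , len , mem =
        l′ , W′ , cong suc len ,
        λ z∈ → let (p , i≤p , p≤j , z≡) = mem z∈ in suc p , s≤s i≤p , s≤s p≤j , z≡

Separates : ∀ {n} → Graph n → List (Fin n) → Fin n → Fin n → Set
Separates G B u u′ = ∀ {l} → Walk (Graph.Adj G) u u′ l → ∃[ z ] (z ∈ l × z ∈ B)

separates-sym : ∀ {n} {G : Graph n} {B u u′} → Separates G B u u′ → Separates G B u′ u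
separates-sym {G = G} sep W with walk-reverse (Graph.symm G) W
... | _ , W′ , _ , mem with sep W′
... | z , z∈ , z∈B = z , mem z∈ , z∈B

module Distance {n} (G : Graph n) (d : Fin n → Fin n → ℕ) (isSPD : IsShortestPathDistance G d) where
  open Graph G using (Adj; symm)

  shortest-walk : ∀ u v → ∃[ l ] IsShortestPath G d u v l
  shortest-walk u v = proj₁ (isSPD u v)

  walk-length≥ : ∀ {u v l} → Walk Adj u v l → suc (d u v) ≤ length l
  walk-length≥ {u} {v} {l} W = proj₂ (isSPD u v) l W

  d≤ : ∀ {u v l m} → Walk Adj u v l → length l ≡ suc m → d u v ≤ m
  d≤ W len = s≤s⁻¹ (≤-trans (walk-length≥ W) (≤-reflexive len))

  d-triangle : ∀ u v w → d u w ≤ d u v + d v w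
  d-triangle u v w with shortest-walk u v | shortest-walk v w
  ... | _ , W₁ , len₁ | _ , W₂ , len₂ with walk-join W₁ W₂
  ... | _ , W , len , _ = d≤ W (suc-injective
        (trans len (trans (cong₂ _+_ len₁ len₂) (cong suc (+-suc (d u v) (d v w))))))

  d-sym : ∀ u v → d u v ≡ d v u
  d-sym u v = ≤-antisym (d-sym≤ v u) (d-sym≤ u v)
    where
    d-sym≤ : ∀ u v → d v u ≤ d u v
    d-sym≤ u v with shortest-walk u v
    ... | _ , W , len with walk-reverse symm W
    ... | _ , W′ , len′ , _ = d≤ W′ (trans len′ len)

  d-through-geodesic : ∀ {u v z l} → IsShortestPath G d u v l → z ∈ l → d u z + d z v ≤ d u v
  d-through-geodesic {u} {v} {z} (W , len) z∈l with walk-split W z∈l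
  ... | _ , _ , W₁ , W₂ , len₁₂ = s≤s⁻¹ (s≤s⁻¹ (begin
    suc (suc (d u z + d z v)) ≡⟨ cong suc (+-suc (d u z) (d z v)) ⟨
    suc (d u z) + suc (d z v) ≤⟨ +-mono-≤ (walk-length≥ W₁) (walk-length≥ W₂) ⟩
    _                         ≡⟨ trans len₁₂ (cong suc len) ⟩
    suc (suc (d u v))         ∎))
    where open ≤-Reasoning

  farther-along-geodesic : ∀ {u v w z l} → IsShortestPath G d v w l → z ∈ l → d v w ≤ d u w → d v z ≤ d u z
  farther-along-geodesic {u} {v} {w} {z} v⇝w z∈l vw≤uw = +-cancelʳ-≤ (d z w) (d v z) (d u z) (begin
    d v z + d z w ≤⟨ d-through-geodesic v⇝w z∈l ⟩
    d v w         ≤⟨ vw≤uw ⟩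
    d u w         ≤⟨ d-triangle u z w ⟩
    d u z + d z w ∎)
    where open ≤-Reasoning

module Subtrees {m} (T : Tree m) where
  open Tree T

  Node : Set
  Node = Fin (suc m)

  infix 4 _⊑_
  data _⊑_ : Node → Node → Set where
    ⊑-refl : ∀ {c} → c ⊑ c
    ⊑-step : ∀ {i c} → parent i ⊑ c → fsuc i ⊑ c

  ancestor-induction : (P : Node → Set) → P fzero → (∀ i → P (parent i) → P (fsuc i)) → ∀ t → P t
  ancestor-induction P P-root P-step t = go (suc (toℕ t)) t ≤-refl
    where
    go : ∀ fuel t → toℕ t < fuel → P t
    go zero       t        ()
    go (suc fuel) fzero    _              = P-root
    go (suc fuel) (fsuc i) (s≤s i<fuel) = P-step i (go fuel (parent i) (≤-trans (s≤s (parent-lt i)) i<fuel))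

  ⊑-root : ∀ t → t ⊑ fzero
  ⊑-root = ancestor-induction (_⊑ fzero) ⊑-refl (λ _ → ⊑-step)

  _⊑?_ : ∀ t c → Dec (t ⊑ c)
  t ⊑? c = ancestor-induction (λ t → Dec (t ⊑ c)) root? step? t
    where
    root? : Dec (fzero ⊑ c)
    root? with fzero Finₚ.≟ c
    ... | yes refl = yes ⊑-refl
    ... | no ≢c    = no λ { ⊑-refl → ≢c refl }
    step? : ∀ i → Dec (parent i ⊑ c) → Dec (fsuc i ⊑ c)
    step? i _ with fsuc i Finₚ.≟ c
    step? i _       | yes refl = yes ⊑-refl
    step? i (yes p) | no _     = yes (⊑-step p)
    step? i (no ¬p) | no ≢c    = no λ { ⊑-refl → ≢c refl ; (⊑-step p) → ¬p p }

  ⊑-child : ∀ {t c} → t ⊑ c → t ≢ c → ∃[ j ] (parent j ≡ c × t ⊑ fsuc j)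
  ⊑-child ⊑-refl t≢c = ⊥-elim (t≢c refl)
  ⊑-child {c = c} (⊑-step {i} p) _ with parent i Finₚ.≟ c
  ... | yes pi≡c = i , pi≡c , ⊑-refl
  ... | no pi≢c with ⊑-child p pi≢c
  ...   | j , pj≡c , q = j , pj≡c , ⊑-step q

  edge-leaving-subtree : ∀ {a b j} → TreeAdj T a b → a ⊑ fsuc j → ¬ b ⊑ fsuc j → b ≡ parent j
  edge-leaving-subtree (_ , inj₁ (refl , refl)) ⊑-refl     _  = refl
  edge-leaving-subtree (_ , inj₁ (refl , refl)) (⊑-step p) b⋢ = ⊥-elim (b⋢ p)
  edge-leaving-subtree (_ , inj₂ (refl , refl)) p          b⋢ = ⊥-elim (b⋢ (⊑-step p))

  walk-leaving-subtree : ∀ {t t′ j l} → Walk (TreeAdj T) t t′ l → t ⊑ fsuc j → ¬ t′ ⊑ fsuc j → parent j ∈ l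
  walk-leaving-subtree (here _) p t′⋢ = ⊥-elim (t′⋢ p)
  walk-leaving-subtree {j = j} (step {w = b} e W) p t′⋢ with b ⊑? fsuc j
  ... | yes q = there (walk-leaving-subtree W q t′⋢)
  ... | no b⋢ = there (subst (_∈ _) (edge-leaving-subtree e p b⋢) (start∈ W))

module Decomposition {n} {G : Graph n} (D : TreeDecomposition G) where
  open TreeDecomposition D
  open Tree tree using (parent; parent-lt)
  open Subtrees tree
  open import Data.List.Membership.DecPropositional (Finₚ._≟_ {n}) using (_∈?_)

  Touches : Fin n → Node → Set
  Touches u c = ∃[ t ] (u ∈ bag t × t ⊑ c)

  Inside : Fin n → Node → Set
  Inside u c = ∀ t → u ∈ bag t → t ⊑ c

  Escapes : Fin n → Node → Set
  Escapes u c = ∃[ t ] (u ∈ bag t × ¬ t ⊑ c)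

  touches? : ∀ u c → Dec (Touches u c)
  touches? u c = Finₚ.any? (λ t → (u ∈? bag t) ×-dec (t ⊑? c))

  escapes? : ∀ u c → Dec (Escapes u c)
  escapes? u c = Finₚ.any? (λ t → (u ∈? bag t) ×-dec ¬? (t ⊑? c))

  ¬escapes⇒inside : ∀ {u c} → ¬ Escapes u c → Inside u c
  ¬escapes⇒inside {u} {c} ¬esc t u∈t with t ⊑? c
  ... | yes t⊑c = t⊑c
  ... | no t⋢c  = ⊥-elim (¬esc (t , u∈t , t⋢c))

  touches-root : ∀ u → Touches u fzero
  touches-root u = let (t , u∈t) = covers u in t , u∈t , ⊑-root t

  in-parent-bag : ∀ {u t t′ j} → u ∈ bag t → u ∈ bag t′ → t ⊑ fsuc j → ¬ t′ ⊑ fsuc j → u ∈ bag (parent j)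
  in-parent-bag {u} {t} {t′} u∈t u∈t′ t⊑ t′⋢ with subtree u t t′ u∈t u∈t′
  ... | _ , W , all = All.lookup all (walk-leaving-subtree W t⊑ t′⋢)

  parent-bag-separates : ∀ {u u′ j} → Inside u (fsuc j) → Escapes u′ (fsuc j) →
                         Separates G (bag (parent j)) u u′
  parent-bag-separates inside (t , u′∈t , t⋢) (here _) = ⊥-elim (t⋢ (inside t u′∈t))
  parent-bag-separates {j = j} inside esc (step {w = w} e W) with edges _ _ e
  ... | t , u∈t , w∈t with escapes? w (fsuc j)
  ...   | yes (t′ , w∈t′ , t′⋢) = w , there (start∈ W) , in-parent-bag w∈t w∈t′ (inside t u∈t) t′⋢
  ...   | no ¬esc with parent-bag-separates (¬escapes⇒inside ¬esc) esc W
  ...     | z , z∈l , z∈B = z , there z∈l , z∈B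

  inside-child : ∀ {u c} → Touches u c → u ∉ bag c → ∃[ j ] (parent j ≡ c × Inside u (fsuc j))
  inside-child {u} {c} (t , u∈t , t⊑c) u∉c with t Finₚ.≟ c
  ... | yes refl = ⊥-elim (u∉c u∈t)
  ... | no t≢c with ⊑-child t⊑c t≢c
  ...   | j , pj≡c , t⊑j = j , pj≡c , inside
    where
    inside : Inside u (fsuc j)
    inside t′ u∈t′ with t′ ⊑? fsuc j
    ... | yes t′⊑j = t′⊑j
    ... | no t′⋢j  = ⊥-elim (u∉c (subst (λ s → u ∈ bag s) pj≡c (in-parent-bag u∈t u∈t′ t⊑j t′⋢j)))

  NoChildTouchesBoth : Node → Fin n → Fin n → Set
  NoChildTouchesBoth c u u′ = ∀ j → parent j ≡ c → Touches u (fsuc j) → Touches u′ (fsuc j) → ⊥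

  bag-separates : ∀ {c u u′} → Touches u c → NoChildTouchesBoth c u u′ → Separates G (bag c) u u′
  bag-separates {c} {u} {u′} tu none W with u ∈? bag c
  ... | yes u∈c = u , start∈ W , u∈c
  ... | no u∉c with inside-child tu u∉c | covers u′ | covers u
  ...   | j , pj≡c , inside | t′ , u′∈t′ | t , u∈t with t′ ⊑? fsuc j
  ...     | yes t′⊑j = ⊥-elim (none j pj≡c (t , u∈t , inside t u∈t) (t′ , u′∈t′ , t′⊑j))
  ...     | no t′⋢j with parent-bag-separates inside (t′ , u′∈t′ , t′⋢j) W
  ...       | z , z∈l , z∈B = z , z∈l , subst (λ s → z ∈ bag s) pj≡c z∈B

  bag-separates′ : ∀ {c u u′} → Touches u c ⊎ Touches u′ c → NoChildTouchesBoth c u u′ →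
                   Separates G (bag c) u u′
  bag-separates′ (inj₁ tu)  none = bag-separates tu none
  bag-separates′ (inj₂ tu′) none = separates-sym {G = G} (bag-separates tu′ (λ j e t t′ → none j e t′ t))

  -- Equivalently: at least two of x, y, v touch c.
  PairsTouch : Fin n → Fin n → Fin n → Node → Set
  PairsTouch x y v c = (Touches x c ⊎ Touches y c) × (Touches x c ⊎ Touches v c) × (Touches y c ⊎ Touches v c)

  pairs-touch? : ∀ x y v c → Dec (PairsTouch x y v c)
  pairs-touch? x y v c = (touches? x c ⊎-dec touches? y c) ×-dec
                         ((touches? x c ⊎-dec touches? v c) ×-dec (touches? y c ⊎-dec touches? v c))

  no-child-beyond : ∀ {P : Node → Set} {c} → (∀ t → toℕ c < toℕ t → ¬ P t) → ∀ j → parent j ≡ c → ¬ P (fsuc j)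
  no-child-beyond {P} deepest j pj≡c = deepest (fsuc j) (subst (λ s → toℕ s < suc (toℕ j)) pj≡c (s≤s (parent-lt j)))

  three-way-separator : ∀ x y v → ∃[ c ] (Separates G (bag c) x y × Separates G (bag c) x v ×
                                          Separates G (bag c) y v)
  three-way-separator x y v with largest-witness (pairs-touch? x y v)
                                (fzero , inj₁ (touches-root x) , inj₁ (touches-root x) , inj₁ (touches-root y))
  ... | c , (xy , xv , yv) , deepest =
        c , bag-separates′ xy (λ j e tx ty → none j e (inj₁ tx , inj₁ tx , inj₁ ty))
          , bag-separates′ xv (λ j e tx tv → none j e (inj₁ tx , inj₁ tx , inj₂ tv))
          , bag-separates′ yv (λ j e ty tv → none j e (inj₂ ty , inj₂ tv , inj₁ ty))
    where none = no-child-beyond deepest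

module Projection {n} (G : Graph n) (d : Fin n → Fin n → ℕ) (isSPD : IsShortestPathDistance G d)
  {B : List (Fin n)} {tl : ℕ} (B-diam : ∀ z z′ → z ∈ B → z′ ∈ B → d z z′ ≤ tl)
  {k : ℕ} {a b : Fin n} {Q : List (Fin n)} (Q-shortest : IsShortestPath G d a b Q)
  (Q-ecc : ∀ u → ∃[ s ] (s ∈ Q × d u s ≤ k)) where

  open Graph G using (Adj; symm)
  open Distance G d isSPD
  open import Data.List.Membership.DecPropositional (Finₚ._≟_ {n}) using (_∈?_)
  open ≤-Reasoning

  -- d(u, B) ≤ k + λ/2, doubled to stay in ℕ.
  Near : Fin n → Set
  Near u = ∃[ z ] (z ∈ B × 2 * d u z ≤ 2 * k + tl)

  near-bag-bound : ∀ {u p} → Near u → p ∈ B → 2 * d u p ≤ 2 * k + 3 * tl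
  near-bag-bound {u} {p} (z , z∈B , near) p∈B =
    ≤-trans (double-+-≤ (d u z) tl (≤-trans (d-triangle u z p) (+-monoʳ-≤ (d u z) (B-diam z p z∈B p∈B))) near)
            (≤-reflexive (collect k tl))
    where
    collect : ∀ k t → 2 * k + t + 2 * t ≡ 2 * k + 3 * t
    collect = solve-∀

  WQ : Walk Adj a b Q
  WQ = proj₁ Q-shortest

  q : ℕ → Fin n
  q = vertex WQ

  L : ℕ
  L = steps WQ

  d-along : ∀ {i j} → i ≤ j → j ≤ L → i + d (q i) (q j) ≤ j
  d-along {i} {j} i≤j j≤L with segment WQ i≤j j≤L
  ... | l , W , len , _ = s≤s⁻¹ (begin
    suc (i + d (q i) (q j)) ≡⟨ +-suc i _ ⟨
    i + suc (d (q i) (q j)) ≤⟨ +-monoʳ-≤ i (walk-length≥ W) ⟩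
    i + length l            ≡⟨ len ⟩
    suc j                   ∎)

  d-from-start : ∀ {i} → i ≤ L → d a (q i) ≡ i
  d-from-start {i} i≤L = ≤-antisym upper lower
    where
    upper : d a (q i) ≤ i
    upper = subst (λ s → d s (q i) ≤ i) (vertex-start WQ) (d-along z≤n i≤L)
    lower : i ≤ d a (q i)
    lower = +-cancelʳ-≤ (d (q i) b) i (d a (q i)) (begin
      i + d (q i) b         ≡⟨ cong (λ s → i + d (q i) s) (vertex-end WQ) ⟨
      i + d (q i) (q L)     ≤⟨ d-along i≤L ≤-refl ⟩
      L                     ≡⟨ suc-injective (trans (sym (length≡suc-steps WQ)) (proj₂ Q-shortest)) ⟩
      d a b                 ≤⟨ d-triangle a (q i) b ⟩
      d a (q i) + d (q i) b ∎)

  -- Only routes missing B are recorded: a shortest route through B already makes u Near.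
  record Projection (u : Fin n) : Set where
    field
      pos          : ℕ
      pos≤         : pos ≤ L
      close        : d u (q pos) ≤ k
      route        : List (Fin n)
      route-walk   : Walk Adj u (q pos) route
      route-avoids : ∀ {z} → z ∈ route → z ∉ B
  open Projection

  near-or-projects : ∀ u → Near u ⊎ Projection u
  near-or-projects u with Q-ecc u
  ... | s , s∈Q , us≤k with ∈⇒vertex WQ s∈Q | shortest-walk u s
  ... | i , i≤L , refl | l , u⇝s with any? (_∈? B) l
  ... | yes hit = let (z , z∈l , z∈B) = find hit in inj₁ (z , z∈B , ≤-trans
          (*-monoʳ-≤ 2 (≤-trans (m≤m+n (d u z) _) (≤-trans (d-through-geodesic u⇝s z∈l) us≤k)))
          (m≤m+n (2 * k) tl))
  ... | no miss = inj₂ (record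
          { pos = i ; pos≤ = i≤L ; close = us≤k ; route = l ; route-walk = proj₁ u⇝s
          ; route-avoids = λ z∈l z∈B → miss (lose z∈l z∈B) })

  projections-meet-bag : ∀ {u u′} (π : Projection u) (π′ : Projection u′) → Separates G B u u′ →
                         pos π ≤ pos π′ → ∃[ p ] (pos π ≤ p × p ≤ pos π′ × q p ∈ B)
  projections-meet-bag π π′ sep π≤π′
    with segment WQ π≤π′ (pos≤ π′) | walk-reverse symm (route-walk π′)
  ... | _ , along , _ , on-Q | _ , back , _ , on-route′ with walk-join (route-walk π) along
  ... | _ , out , _ , on-out with walk-join out back
  ... | _ , W , _ , on-W with sep W
  ... | z , z∈W , z∈B with on-W z∈W
  ... | inj₂ z∈back = ⊥-elim (route-avoids π′ (on-route′ z∈back) z∈B)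
  ... | inj₁ z∈out with on-out z∈out
  ...   | inj₁ z∈route = ⊥-elim (route-avoids π z∈route z∈B)
  ...   | inj₂ z∈Q with on-Q z∈Q
  ...     | p , π≤p , p≤π′ , refl = p , π≤p , p≤π′ , z∈B

  crossings-close : ∀ {p₁ r p₂} → p₁ ≤ r → r ≤ p₂ → p₂ ≤ L → q p₁ ∈ B → q p₂ ∈ B →
                    d (q r) (q p₁) + d (q r) (q p₂) ≤ tl
  crossings-close {p₁} {r} {p₂} p₁≤r r≤p₂ p₂≤L p₁∈B p₂∈B = gaps-≤ _ _ left (d-along r≤p₂ p₂≤L) span
    where
    left : p₁ + d (q r) (q p₁) ≤ r
    left = subst (λ s → p₁ + s ≤ r) (d-sym (q p₁) (q r)) (d-along p₁≤r (≤-trans r≤p₂ p₂≤L))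
    span : p₂ ≤ p₁ + tl
    span = begin
      p₂                           ≡⟨ d-from-start p₂≤L ⟨
      d a (q p₂)                   ≤⟨ d-triangle a (q p₁) (q p₂) ⟩
      d a (q p₁) + d (q p₁) (q p₂) ≤⟨ +-mono-≤ (≤-reflexive (d-from-start (≤-trans p₁≤r (≤-trans r≤p₂ p₂≤L))))
                                               (B-diam _ _ p₁∈B p₂∈B) ⟩
      p₁ + tl                      ∎

  near-via-Q : ∀ {u i z} → d u (q i) ≤ k → z ∈ B → 2 * d (q i) z ≤ tl → Near u
  near-via-Q {u} {i} {z} close z∈B half = z , z∈B , (begin
    2 * d u z ≤⟨ double-+-≤ (d (q i) z) k (≤-trans (d-triangle u (q i) z) (≤-trans (+-monoˡ-≤ _ close)
                                                               (≤-reflexive (+-comm k _)))) half ⟩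
    tl + 2 * k ≡⟨ +-comm tl (2 * k) ⟩
    2 * k + tl ∎)

  middle-near-ordered : ∀ {u w u′} (π : Projection u) (ρ : Projection w) (π′ : Projection u′) →
                        pos π ≤ pos ρ → pos ρ ≤ pos π′ → Separates G B u w → Separates G B w u′ → Near w
  middle-near-ordered π ρ π′ π≤ρ ρ≤π′ sep sep′
    with projections-meet-bag π ρ sep π≤ρ | projections-meet-bag ρ π′ sep′ ρ≤π′
  ... | p₁ , _ , p₁≤ρ , p₁∈B | p₂ , ρ≤p₂ , p₂≤π′ , p₂∈B
    with smaller-half (d (q (pos ρ)) (q p₁)) (d (q (pos ρ)) (q p₂)) (crossings-close p₁≤ρ ρ≤p₂ (≤-trans p₂≤π′ (pos≤ π′)) p₁∈B p₂∈B)
  ... | inj₁ half = near-via-Q {i = pos ρ} (close ρ) p₁∈B half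
  ... | inj₂ half = near-via-Q {i = pos ρ} (close ρ) p₂∈B half

  middle-near : ∀ {u w u′} (π : Projection u) (ρ : Projection w) (π′ : Projection u′) →
                Between (pos π) (pos ρ) (pos π′) → Separates G B u w → Separates G B w u′ → Near w
  middle-near π ρ π′ (inj₁ (π≤ρ , ρ≤π′)) sep sep′ = middle-near-ordered π ρ π′ π≤ρ ρ≤π′ sep sep′
  middle-near π ρ π′ (inj₂ (π′≤ρ , ρ≤π)) sep sep′ =
    middle-near-ordered π′ ρ π π′≤ρ ρ≤π (separates-sym {G = G} sep′) (separates-sym {G = G} sep)

  one-of-three-near : ∀ {x y v} → Separates G B x y → Separates G B x v → Separates G B y v →
                      Near x ⊎ Near y ⊎ Near v
  one-of-three-near {x} {y} {v} xy xv yv with near-or-projects x | near-or-projects y | near-or-projects v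
  ... | inj₁ near | _        | _        = inj₁ near
  ... | inj₂ _    | inj₁ near | _       = inj₂ (inj₁ near)
  ... | inj₂ _    | inj₂ _   | inj₁ near = inj₂ (inj₂ near)
  ... | inj₂ πx   | inj₂ πy  | inj₂ πv with middle-of-three (pos πx) (pos πy) (pos πv)
  ...   | inj₁ x-mid        = inj₁ (middle-near πy πx πv x-mid (separates-sym {G = G} xy) xv)
  ...   | inj₂ (inj₁ y-mid) = inj₂ (inj₁ (middle-near πx πy πv y-mid xy yv))
  ...   | inj₂ (inj₂ v-mid) = inj₂ (inj₂ (middle-near πx πv πy v-mid xv (separates-sym {G = G} yv)))

  bound-via-near-end : ∀ {u w v p} → d v w ≤ d u w → Separates G B v w → Near u → p ∈ B →
                       2 * d v p ≤ 2 * k + 5 * tl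
  bound-via-near-end {u} {w} {v} {p} vw≤uw sep near-u p∈B with shortest-walk v w
  ... | _ , v⇝w with sep (proj₁ v⇝w)
  ... | c , c∈l , c∈B = begin
    2 * d v p              ≤⟨ double-+-≤ (d v c) tl (≤-trans (d-triangle v c p) (+-monoʳ-≤ (d v c) (B-diam c p c∈B p∈B)))
                                         (≤-trans (*-monoʳ-≤ 2 (farther-along-geodesic v⇝w c∈l vw≤uw))
                                                  (near-bag-bound near-u c∈B)) ⟩
    2 * k + 3 * tl + 2 * tl ≡⟨ collect k tl ⟩
    2 * k + 5 * tl         ∎
    where
    collect : ∀ k t → 2 * k + 3 * t + 2 * t ≡ 2 * k + 5 * t
    collect = solve-∀

  far-vertex-bound : ∀ {x y v p} → d v y ≤ d x y → d v x ≤ d y x →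
                     Separates G B x y → Separates G B x v → Separates G B y v → p ∈ B →
                     2 * d v p ≤ 2 * k + 5 * tl
  far-vertex-bound vy≤xy vx≤yx xy xv yv p∈B with one-of-three-near xy xv yv
  ... | inj₁ near-x        = bound-via-near-end vy≤xy (separates-sym {G = G} yv) near-x p∈B
  ... | inj₂ (inj₁ near-y) = bound-via-near-end vx≤yx (separates-sym {G = G} xv) near-y p∈B
  ... | inj₂ (inj₂ near-v) = ≤-trans (near-bag-bound near-v p∈B) (+-monoʳ-≤ (2 * k) (*-monoˡ-≤ tl (m≤m+n 3 2)))

lemma18 : ∀ {n} (G : Graph n) (d : Fin n → Fin n → ℕ) → IsShortestPathDistance G d →
          (tl : ℕ) → HasTreeLength G d tl →
          (k : ℕ) → (∃[ a ] ∃[ b ] ∃[ Q ] (IsShortestPath G d a b Q × EccSet d Q k)) →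
          (x y : Fin n) → MutuallyFurthest d x y →
          (P : List (Fin n)) → IsShortestPath G d x y P →
          (e : ℕ) → EccSet d P e → 2 * e ≤ 2 * k + 5 * tl
lemma18 G d isSPD tl (D , bag-diam) k (_ , _ , _ , Q-shortest , Q-ecc , _) x y (ecc-x , ecc-y) P (P-walk , _)
        e (_ , v , v-far)
  with Decomposition.three-way-separator D x y v
... | c , xy , xv , yv with xy P-walk
... | p , p∈P , p∈B = begin
  2 * e          ≤⟨ *-monoʳ-≤ 2 (v-far p p∈P) ⟩
  2 * d v p      ≤⟨ Projection.far-vertex-bound G d isSPD (bag-diam c) Q-shortest Q-ecc vy≤xy vx≤yx xy xv yv p∈B ⟩
  2 * k + 5 * tl ∎
  where
  open ≤-Reasoning
  open Distance G d isSPD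
  vy≤xy : d v y ≤ d x y
  vy≤xy = subst (_≤ d x y) (d-sym y v) (proj₁ ecc-y v)
  vx≤yx : d v x ≤ d y x
  vx≤yx = subst₂ _≤_ (d-sym x v) (d-sym x y) (proj₁ ecc-x v)
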